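{- Let $k\geq 1$, $m$ and $t$ be integers with $t\leq \frac{m}{2}-1$. Let $\mathcal{R}$ be the graph obtained from $K_{(k-1)(m-1)+1}$ by deleting the edges of a matching with $t$ edges ($tK_2$), and let $G$ be the graph obtained from $K_m$ by deleting the edges of a matching with $t$ edges. Then $\mathcal{R}$ is $k$-$G$-free-minimal.
   Context: All graphs are finite, simple and undirected. For a graph $G$ on at least 2 vertices, a $G$-free $k$-colouring of a graph $H$ is a map $\pi:V(H)\to\{1,\dots,k\}$ such that for every $i$ the subgraph of $H$ induced by $\pi^{ -1}(i)$ contains no subgraph isomorphic to $G$. The $G$-free chromatic number $\chi_G(H)$ is the least $k$ for which a $G$-free $k$-colouring of $H$ exists. $H$ is $G$-free-minimal if $\chi_G(H\setminus\{e\})=\chi_G(H)-1$ for every edge $e\in E(H)$; $H$ is $k$-$G$-free-minimal if moreover $\chi_G(H)=k$. -}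

module Defs where

open import Data.Nat using (ℕ; zero; suc; _+_; _*_; _∸_; _<_; _≤_)
open import Data.Fin using (Fin)
open import Data.Product using (Σ; _×_; _,_; proj₁; proj₂)
open import Data.Sum using (_⊎_; inj₁; inj₂)
open import Data.Empty using (⊥)
open import Relation.Nullary using (¬_)
open import Relation.Binary.PropositionalEquality using (_≡_; _≢_; refl; sym)
open import Function.Definitions using (Injective)

record Graph : Set₁ where
  field
    n      : ℕ
    Adj    : Fin n → Fin n → Set
    adjSym : ∀ {u v} → Adj u v → Adj v u
    irrefl : ∀ {u} → ¬ Adj u u
open Graph public

ContainsIn : (G H : Graph) → (Fin (n H) → Set) → Set
ContainsIn G H S =
  Σ (Fin (n G) → Fin (n H)) λ f →
    Injective _≡_ _≡_ f
    × (∀ x → S (f x))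
    × (∀ x y → Adj G x y → Adj H (f x) (f y))

IsGFreeColouring : (G H : Graph) (k : ℕ) → (Fin (n H) → Fin k) → Set
IsGFreeColouring G H k π = ∀ (i : Fin k) → ¬ ContainsIn G H (λ v → π v ≡ i)

GFreeColourable : (G H : Graph) → ℕ → Set
GFreeColourable G H k = Σ (Fin (n H) → Fin k) (IsGFreeColouring G H k)

IsGFreeChromaticNumber : (G H : Graph) → ℕ → Set
IsGFreeChromaticNumber G H k =
  GFreeColourable G H k × (∀ j → j < k → ¬ GFreeColourable G H j)

deleteEdge : (H : Graph) → Fin (n H) → Fin (n H) → Graph
deleteEdge H u v = record
  { n = n H
  ; Adj = λ x y → Adj H x y × ¬ ((x ≡ u × y ≡ v) ⊎ (x ≡ v × y ≡ u))
  ; adjSym = λ { (a , ne) → adjSym H a , λ { (inj₁ (p , q)) → ne (inj₂ (q , p))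
                                            ; (inj₂ (p , q)) → ne (inj₁ (q , p)) } }
  ; irrefl = λ { (a , _) → irrefl H a }
  }

IsKGFreeMinimal : (k : ℕ) (G H : Graph) → Set
IsKGFreeMinimal k G H =
  IsGFreeChromaticNumber G H k
  × (∀ u v → Adj H u v → IsGFreeChromaticNumber G (deleteEdge H u v) (k ∸ 1))

IsMatching : {N t : ℕ} → (Fin t → Fin N) → (Fin t → Fin N) → Set
IsMatching a b = Injective _≡_ _≡_ a × Injective _≡_ _≡_ b × (∀ i j → a i ≢ b j)

completeMinus : (N t : ℕ) → (Fin t → Fin N) → (Fin t → Fin N) → Graph
completeMinus N t a b = record
  { n = N
  ; Adj = λ x y → x ≢ y × ¬ Σ (Fin t) (λ i → (x ≡ a i × y ≡ b i) ⊎ (x ≡ b i × y ≡ a i))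
  ; adjSym = λ { (ne , nm) → (λ e → ne (sym e)) ,
                   λ { (i , inj₁ (p , q)) → nm (i , inj₂ (q , p))
                     ; (i , inj₂ (p , q)) → nm (i , inj₁ (q , p)) } }
  ; irrefl = λ { (ne , _) → ne refl }
  }

-- Any m vertices of R span a copy of G: order them so that the matching of R meets them
-- along the matching of G.  Hence every class of a G-free colouring of R has at most m − 1
-- vertices, while m − 1 vertices never contain G; so χ_G(R) = k.  After deleting an edge uv,
-- k − 2 classes of size m − 1 still cannot hold the (k − 1)(m − 1) vertices other than u.
-- Conversely, pick at most m vertices that no copy of G in R − uv contains all of: u, its
-- partner in the matching and v if u is matched (symmetrically for v); otherwise u, v and all
-- 2t matched vertices.  Put them in a class of exactly m vertices and split the remaining
-- (k − 2)(m − 1) vertices into classes of m − 1: this is a G-free (k − 1)-colouring.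
module Submission where

open import Defs
open import Data.Nat using (ℕ; zero; suc; _+_; _*_; _∸_; _≤_; _<_; z≤n; s≤s; _<?_)
open import Data.Nat.Properties
  using (1+n≰n; ≮⇒≥; <⇒≱; n<1+n; m<n⇒m<1+n; m≤n+m; +-comm; +-monoˡ-≤; *-monoˡ-≤; ≤-trans)
open import Data.Fin
  using (Fin; zero; suc; toℕ; fromℕ<; inject≤; punchOut; combine; quotient; remainder; splitAt; join; _↑ˡ_; _↑ʳ_)
open import Data.Fin.Properties
  using (any?; suc-injective; injective⇒≤; <⇒notInjective; punchOut-injective; toℕ-injective; toℕ<n;
         toℕ-inject≤; inject≤-injective; ↑ˡ-injective; combine-injectiveˡ; combine-injectiveʳ; combine-remQuot;
         splitAt-↑ˡ; splitAt-↑ʳ; splitAt⁻¹-↑ˡ; splitAt⁻¹-↑ʳ; join-splitAt)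
  renaming (_≟_ to _≟ᶠ_)
open import Data.Fin.Permutation using (Permutation; _⟨$⟩ʳ_; _⟨$⟩ˡ_; _∘ₚ_; transpose; cast-id; inverseˡ; inverseʳ)
import Data.Fin.Permutation.Components as Components
open import Data.List using (List; []; _∷_; length; lookup; filter; allFin)
open import Data.List.Relation.Unary.Any using (index)
open import Data.List.Relation.Unary.Any.Properties using (lookup-index)
import Data.List.Relation.Unary.All as All
open import Data.List.Relation.Unary.AllPairs using (_∷_)
open import Data.List.Relation.Unary.Unique.Propositional using (Unique)
open import Data.List.Relation.Unary.Unique.Propositional.Properties using (filter⁺; allFin⁺)
open import Data.List.Membership.Propositional.Properties using (∈-filter⁺; ∈-filter⁻; ∈-allFin; ∈-lookup)
import Data.Vec as Vec
open import Data.Vec using (_∷_; [])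
open import Data.Vec.Relation.Unary.All using (_∷_; [])
open import Data.Vec.Relation.Unary.AllPairs using (_∷_; [])
open import Data.Vec.Relation.Unary.Unique.Propositional.Properties
  using () renaming (lookup-injective to Vec-lookup-injective)
open import Data.Product using (Σ; ∃; ∃₂; _×_; _,_; proj₁; proj₂)
open import Data.Sum using (_⊎_; inj₁; inj₂; [_,_]′)
open import Function using (_∘_)
open import Function.Definitions using (Injective)
open import Relation.Nullary using (¬_; yes; no; contradiction)
open import Relation.Nullary.Decidable using (dec-true; dec-false; _×-dec_; _⊎-dec_)
open import Relation.Binary.PropositionalEquality

-- Finite sets

injective⇒surjective : ∀ {s} {h : Fin s → Fin s} → Injective _≡_ _≡_ h → ∀ y → ∃ λ x → h x ≡ y
injective⇒surjective {suc s} {h} h-injective y with any? (λ x → h x ≟ᶠ y)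
... | yes hit = hit
... | no miss = contradiction (injective⇒≤ squeezed-injective) 1+n≰n
  where
  missed : ∀ x → y ≢ h x
  missed x y≡hx = miss (x , sym y≡hx)

  squeezed : Fin (suc s) → Fin s
  squeezed x = punchOut (missed x)

  squeezed-injective : Injective _≡_ _≡_ squeezed
  squeezed-injective {x} {x'} = h-injective ∘ punchOut-injective (missed x) (missed x')

lookup-injective : ∀ {A : Set} {xs : List A} → Unique xs → Injective _≡_ _≡_ (lookup xs)
lookup-injective (_ ∷ _) {zero} {zero} _ = refl
lookup-injective (x∉xs ∷ _) {zero} {suc j} eq = contradiction eq (All.lookup x∉xs (∈-lookup j))
lookup-injective (x∉xs ∷ _) {suc i} {zero} eq = contradiction (sym eq) (All.lookup x∉xs (∈-lookup i))
lookup-injective (_ ∷ xs-unique) {suc i} {suc j} eq = cong suc (lookup-injective xs-unique eq)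

either-splitAt-injective : ∀ {A : Set} {k l} {f : Fin k → A} {g : Fin l → A} →
  Injective _≡_ _≡_ f → Injective _≡_ _≡_ g → (∀ x y → f x ≢ g y) →
  Injective _≡_ _≡_ (λ p → [ f , g ]′ (splitAt k p))
either-splitAt-injective {k = k} {l} {f} {g} f-injective g-injective f≢g {p} {q} eq = begin
  p                       ≡⟨ join-splitAt k l p ⟨
  join k l (splitAt k p)  ≡⟨ cong (join k l) (either-injective (splitAt k p) (splitAt k q) eq) ⟩
  join k l (splitAt k q)  ≡⟨ join-splitAt k l q ⟩
  q                       ∎
  where
  open ≡-Reasoning
  either-injective : ∀ x y → [ f , g ]′ x ≡ [ f , g ]′ y → x ≡ y
  either-injective (inj₁ x) (inj₁ y) eq = cong inj₁ (f-injective eq)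
  either-injective (inj₁ x) (inj₂ y) eq = contradiction eq (f≢g x y)
  either-injective (inj₂ x) (inj₁ y) eq = contradiction (sym eq) (f≢g y x)
  either-injective (inj₂ x) (inj₂ y) eq = cong inj₂ (g-injective eq)

quotient-remainder-injective : ∀ {j} r {p q : Fin (j * r)} →
  quotient {j} r p ≡ quotient {j} r q → remainder {j} r p ≡ remainder {j} r q → p ≡ q
quotient-remainder-injective {j} r {p} {q} quot rem = begin
  p                                               ≡⟨ combine-remQuot {j} r p ⟨
  combine (quotient {j} r p) (remainder {j} r p)  ≡⟨ cong₂ (combine {j} {r}) quot rem ⟩
  combine (quotient {j} r q) (remainder {j} r q)  ≡⟨ combine-remQuot {j} r q ⟩
  q                                               ∎
  where open ≡-Reasoning

⟨$⟩ʳ-injective : ∀ {A A'} (σ : Permutation A A') → Injective _≡_ _≡_ (σ ⟨$⟩ʳ_)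
⟨$⟩ʳ-injective σ eq = trans (sym (inverseˡ σ)) (trans (cong (σ ⟨$⟩ˡ_) eq) (inverseˡ σ))

transpose-here : ∀ {s} (i j : Fin s) → Components.transpose i j i ≡ j
transpose-here i j rewrite dec-true (i ≟ᶠ i) refl = refl

transpose-elsewhere : ∀ {s} {i j k : Fin s} → k ≢ i → k ≢ j → Components.transpose i j k ≡ k
transpose-elsewhere {i = i} {j} {k} k≢i k≢j rewrite dec-false (k ≟ᶠ i) k≢i | dec-false (k ≟ᶠ j) k≢j = refl

aligningPermutation : ∀ {A A' B s} → A ≡ A' → (f : Fin A' → Fin B) {src : Fin s → Fin A} {tgt : Fin s → Fin B} →
  Injective _≡_ _≡_ src → Injective _≡_ _≡_ tgt →
  ∃ λ (σ : Permutation A A') → ∀ i → (∃ λ x → f x ≡ tgt i) → f (σ ⟨$⟩ʳ src i) ≡ tgt i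
aligningPermutation {s = zero} A≡A' f _ _ = cast-id A≡A' , λ ()
aligningPermutation {s = suc s} A≡A' f {src} {tgt} src-injective tgt-injective
  with σ , aligned ← aligningPermutation A≡A' f (suc-injective ∘ src-injective) (suc-injective ∘ tgt-injective)
  with any? (λ x → f x ≟ᶠ tgt zero)
... | no unreachable = σ , λ { zero reachable → contradiction reachable unreachable ; (suc i) → aligned i }
... | yes (x₀ , fx₀≡) = transpose (src zero) y ∘ₚ σ , realigned
  where
  y = σ ⟨$⟩ˡ x₀

  fσy : f (σ ⟨$⟩ʳ y) ≡ tgt zero
  fσy = trans (cong f (inverseʳ σ)) fx₀≡

  realigned : ∀ i → (∃ λ x → f x ≡ tgt i) → f (σ ⟨$⟩ʳ Components.transpose (src zero) y (src i)) ≡ tgt i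
  realigned zero _ = trans (cong (λ z → f (σ ⟨$⟩ʳ z)) (transpose-here (src zero) y)) fσy
  realigned (suc i) reachable with src (suc i) ≟ᶠ y
  ... | yes srcᵢ≡y =
    contradiction (tgt-injective (trans (sym fσy) (trans (cong (λ z → f (σ ⟨$⟩ʳ z)) (sym srcᵢ≡y)) (aligned i reachable))))
                  λ ()
  ... | no srcᵢ≢y =
    trans (cong (λ z → f (σ ⟨$⟩ʳ z)) (transpose-elsewhere (λ eq → contradiction (src-injective eq) λ ()) srcᵢ≢y))
          (aligned i reachable)

-- Colour classes

module _ {s j : ℕ} (π : Fin s → Fin j) where

  colourClass : Fin j → List (Fin s)
  colourClass i = filter (λ w → π w ≟ᶠ i) (allFin s)

  rank : ∀ w → Fin (length (colourClass (π w)))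
  rank w = index (∈-filter⁺ (λ v → π v ≟ᶠ π w) (∈-allFin w) refl)

  lookup-rank : ∀ w → lookup (colourClass (π w)) (rank w) ≡ w
  lookup-rank w = sym (lookup-index (∈-filter⁺ (λ v → π v ≟ᶠ π w) (∈-allFin w) refl))

  smallClasses⇒≤ : ∀ {r} → (∀ i → length (colourClass i) ≤ r) → s ≤ j * r
  smallClasses⇒≤ {r} small = injective⇒≤ code-injective
    where
    code : Fin s → Fin (j * r)
    code w = combine (π w) (inject≤ (rank w) (small (π w)))

    sameLookup : ∀ {i i'} → i ≡ i' → (p : Fin (length (colourClass i))) (q : Fin (length (colourClass i'))) →
                 toℕ p ≡ toℕ q → lookup (colourClass i) p ≡ lookup (colourClass i') q
    sameLookup {i} refl p q p≡q = cong (lookup (colourClass i)) (toℕ-injective p≡q)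

    code-injective : Injective _≡_ _≡_ code
    code-injective {v} {w} eq = begin
      v                                       ≡⟨ lookup-rank v ⟨
      lookup (colourClass (π v)) (rank v)     ≡⟨ sameLookup πv≡πw (rank v) (rank w) ranks ⟩
      lookup (colourClass (π w)) (rank w)     ≡⟨ lookup-rank w ⟩
      w                                       ∎
      where
      open ≡-Reasoning
      rank≤ : ∀ w → Fin r
      rank≤ w = inject≤ (rank w) (small (π w))

      πv≡πw : π v ≡ π w
      πv≡πw = combine-injectiveˡ (π v) (rank≤ v) (π w) (rank≤ w) eq

      ranks : toℕ (rank v) ≡ toℕ (rank w)
      ranks = trans (sym (toℕ-inject≤ (rank v) (small (π v))))
                (trans (cong toℕ (combine-injectiveʳ (π v) (rank≤ v) (π w) (rank≤ w) eq))
                       (toℕ-inject≤ (rank w) (small (π w))))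

  largeClass : ∀ {r} → j * r < s →
    ∃₂ λ (i : Fin j) (g : Fin (suc r) → Fin s) → Injective _≡_ _≡_ g × (∀ x → π (g x) ≡ i)
  largeClass {r} jr<s with any? (λ i → r <? length (colourClass i))
  ... | yes (i , r<∣i∣) = i , g , g-injective , g-coloured
    where
    g : Fin (suc r) → Fin s
    g x = lookup (colourClass i) (inject≤ x r<∣i∣)

    g-injective : Injective _≡_ _≡_ g
    g-injective {x} {x'} =
      inject≤-injective r<∣i∣ r<∣i∣ x x' ∘ lookup-injective (filter⁺ (λ w → π w ≟ᶠ i) {xs = allFin s} (allFin⁺ s))

    g-coloured : ∀ x → π (g x) ≡ i
    g-coloured x = proj₂ (∈-filter⁻ (λ w → π w ≟ᶠ i) {xs = allFin s} (∈-lookup {xs = colourClass i} (inject≤ x r<∣i∣)))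
  ... | no noLarge = contradiction (smallClasses⇒≤ λ i → ≮⇒≥ (λ r<∣i∣ → noLarge (i , r<∣i∣))) (<⇒≱ jr<s)

-- Colourings with small classes

Hom : (G H : Graph) → (Fin (n G) → Fin (n H)) → Set
Hom G H f = ∀ x y → Adj G x y → Adj H (f x) (f y)

hom-deleteEdge : ∀ {G H f u v} → Hom G H f → (∀ x → f x ≢ u) → Hom G (deleteEdge H u v) f
hom-deleteEdge hom avoids x y x~y =
  hom x y x~y , λ { (inj₁ (fx≡u , _)) → avoids x fx≡u ; (inj₂ (_ , fy≡u)) → avoids y fy≡u }

containsIn⇒≤ : ∀ {G H S r} → ContainsIn G H S → (ρ : ∀ w → S w → Fin r) →
  (∀ {v w} (v∈S : S v) (w∈S : S w) → ρ v v∈S ≡ ρ w w∈S → v ≡ w) → n G ≤ r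
containsIn⇒≤ (f , f-injective , f∈S , _) ρ ρ-injective = injective⇒≤ (f-injective ∘ ρ-injective (f∈S _) (f∈S _))

fewVertices⇒colourable : ∀ G H {j r} → r < n G → n H ≤ j * r → GFreeColourable G H j
fewVertices⇒colourable G H {j} {r} r<∣G∣ ∣H∣≤jr = colour , free
  where
  slot : Fin (n H) → Fin (j * r)
  slot w = inject≤ w ∣H∣≤jr

  colour : Fin (n H) → Fin j
  colour w = quotient {j} r (slot w)

  free : IsGFreeColouring G H j colour
  free i copy = <⇒≱ r<∣G∣ (containsIn⇒≤ {G} {H} copy (λ w _ → remainder {j} r (slot w)) slot-injective)
    where
    slot-injective : ∀ {v w} → colour v ≡ i → colour w ≡ i → remainder {j} r (slot v) ≡ remainder {j} r (slot w) → v ≡ w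
    slot-injective {v} {w} v∈i w∈i =
      inject≤-injective ∣H∣≤jr ∣H∣≤jr v w ∘ quotient-remainder-injective r (trans v∈i (sym w∈i))

blockColour : ∀ m {j} r → Fin (m + j * r) → Fin (suc j)
blockColour m {j} r p = [ (λ _ → zero) , (λ q → suc (quotient {j} r q)) ]′ (splitAt m p)

blockColour≡zero : ∀ {m j r} {p : Fin (m + j * r)} → blockColour m {j} r p ≡ zero → ∃ λ l → l ↑ˡ (j * r) ≡ p
blockColour≡zero {m} {p = p} p∈first with splitAt m p in split
... | inj₁ l = l , splitAt⁻¹-↑ˡ split

blockColour≡suc : ∀ {m j r} {p : Fin (m + j * r)} {i} → blockColour m {j} r p ≡ suc i →
  ∃ λ q → m ↑ʳ q ≡ p × quotient {j} r q ≡ i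
blockColour≡suc {m} {p = p} p∈i with splitAt m p in split
... | inj₂ q = q , splitAt⁻¹-↑ʳ split , suc-injective p∈i

module BlockColouring (G H : Graph) {j r : ℕ}
         (τ : Fin (n H) → Fin (n G + j * r)) (τ-injective : Injective _≡_ _≡_ τ) where

  colour : Fin (n H) → Fin (suc j)
  colour w = blockColour (n G) {j} r (τ w)

  firstBlock-covered : (f : Fin (n G) → Fin (n H)) → Injective _≡_ _≡_ f → (∀ x → colour (f x) ≡ zero) →
    ∀ l → ∃ λ x → τ (f x) ≡ l ↑ˡ (j * r)
  firstBlock-covered f f-injective f∈first l = x , trans (sym (proj₂ (first x))) (cong (_↑ˡ (j * r)) (proj₂ hit))
    where
    first : ∀ x → ∃ λ l → l ↑ˡ (j * r) ≡ τ (f x)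
    first x = blockColour≡zero {n G} {j} {r} (f∈first x)

    index-injective : Injective _≡_ _≡_ (proj₁ ∘ first)
    index-injective {x} {y} eq = f-injective (τ-injective (begin
      τ (f x)                      ≡⟨ proj₂ (first x) ⟨
      proj₁ (first x) ↑ˡ (j * r)   ≡⟨ cong (_↑ˡ (j * r)) eq ⟩
      proj₁ (first y) ↑ˡ (j * r)   ≡⟨ proj₂ (first y) ⟩
      τ (f y)                      ∎))
      where open ≡-Reasoning

    hit = injective⇒surjective index-injective l
    x = proj₁ hit

  blockColouring-free : r < n G → ¬ ContainsIn G H (λ w → colour w ≡ zero) → IsGFreeColouring G H (suc j) colour
  blockColouring-free r<∣G∣ firstFree zero = firstFree
  blockColouring-free r<∣G∣ firstFree (suc i) copy =
    <⇒≱ r<∣G∣ (containsIn⇒≤ {G} {H} copy (λ w w∈i → remainder {j} r (offset w∈i)) offset-injective)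
    where
    offset : ∀ {w} → colour w ≡ suc i → Fin (j * r)
    offset w∈i = proj₁ (blockColour≡suc {n G} {j} {r} w∈i)

    offset-injective : ∀ {v w} (v∈i : colour v ≡ suc i) (w∈i : colour w ≡ suc i) →
      remainder {j} r (offset v∈i) ≡ remainder {j} r (offset w∈i) → v ≡ w
    offset-injective v∈i w∈i eq
      with _ , τv≡ , qv ← blockColour≡suc {n G} {j} {r} v∈i
         | _ , τw≡ , qw ← blockColour≡suc {n G} {j} {r} w∈i
      = τ-injective (trans (sym τv≡) (trans (cong (n G ↑ʳ_) (quotient-remainder-injective r (trans qv (sym qw)) eq)) τw≡))

-- Move e into the first block of n G positions; a copy of G inside that block fills it.
uncovered⇒colourable : ∀ G H {j r s} → r < n G → n H ≡ n G + j * r → s ≤ n G →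
  (e : Fin s → Fin (n H)) → Injective _≡_ _≡_ e →
  (∀ f → Injective _≡_ _≡_ f → Hom G H f → ¬ (∀ y → ∃ λ x → f x ≡ e y)) →
  GFreeColourable G H (suc j)
uncovered⇒colourable G H {j} {r} {s} r<∣G∣ sizes s≤∣G∣ e e-injective uncovered =
  colour , blockColouring-free r<∣G∣ firstFree
  where
  slot : Fin s → Fin (n G + j * r)
  slot y = inject≤ y s≤∣G∣ ↑ˡ (j * r)

  slot-injective : Injective _≡_ _≡_ slot
  slot-injective {y} {y'} = inject≤-injective s≤∣G∣ s≤∣G∣ y y' ∘ ↑ˡ-injective (j * r) _ _

  alignment = aligningPermutation sizes (λ p → p) e-injective slot-injective
  σ = proj₁ alignment

  open BlockColouring G H {j} {r} (σ ⟨$⟩ʳ_) (⟨$⟩ʳ-injective σ)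

  firstFree : ¬ ContainsIn G H (λ w → colour w ≡ zero)
  firstFree (f , f-injective , f∈first , hom) = uncovered f f-injective hom covered
    where
    covered : ∀ y → ∃ λ x → f x ≡ e y
    covered y with x , σfx≡ ← firstBlock-covered f f-injective f∈first (inject≤ y s≤∣G∣)
      = x , ⟨$⟩ʳ-injective σ (trans σfx≡ (sym (proj₂ alignment y (slot y , refl))))

-- Matchings

module _ {V t : ℕ} (a b : Fin t → Fin V) where

  Matched : Fin V → Fin V → Set
  Matched x y = Σ (Fin t) λ i → (x ≡ a i × y ≡ b i) ⊎ (x ≡ b i × y ≡ a i)

  endpoint : Fin (t + t) → Fin V
  endpoint p = [ a , b ]′ (splitAt t p)

  endpoint-↑ˡ : ∀ i → endpoint (i ↑ˡ t) ≡ a i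
  endpoint-↑ˡ i = cong [ a , b ]′ (splitAt-↑ˡ t i t)

  endpoint-↑ʳ : ∀ i → endpoint (t ↑ʳ i) ≡ b i
  endpoint-↑ʳ i = cong [ a , b ]′ (splitAt-↑ʳ t t i)

  ¬adjacent⇒matched : ∀ {x y} → x ≢ y → ¬ Adj (completeMinus V t a b) x y → Matched x y
  ¬adjacent⇒matched {x} {y} x≢y ¬x~y
    with any? (λ i → ((x ≟ᶠ a i) ×-dec (y ≟ᶠ b i)) ⊎-dec ((x ≟ᶠ b i) ×-dec (y ≟ᶠ a i)))
  ... | yes matched = matched
  ... | no unmatched = contradiction (x≢y , unmatched) ¬x~y

  endpoint-matched : ∀ p → ∃ λ q → Matched (endpoint p) (endpoint q)
  endpoint-matched p with splitAt t p
  ... | inj₁ i = t ↑ʳ i , i , inj₁ (refl , endpoint-↑ʳ i)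
  ... | inj₂ i = i ↑ˡ t , i , inj₂ (refl , endpoint-↑ˡ i)

  matched⇒endpoint : ∀ {x y} → Matched x y → ∃ λ p → endpoint p ≡ x
  matched⇒endpoint (i , inj₁ (x≡ai , _)) = i ↑ˡ t , trans (endpoint-↑ˡ i) (sym x≡ai)
  matched⇒endpoint (i , inj₂ (x≡bi , _)) = t ↑ʳ i , trans (endpoint-↑ʳ i) (sym x≡bi)

  module _ (ab : IsMatching a b) where
    private
      a-injective = proj₁ ab
      b-injective = proj₁ (proj₂ ab)
      a≢b = proj₂ (proj₂ ab)

    matched⇒≢ : ∀ {x y} → Matched x y → x ≢ y
    matched⇒≢ (i , inj₁ (x≡ai , y≡bi)) x≡y = a≢b i i (trans (sym x≡ai) (trans x≡y y≡bi))
    matched⇒≢ (i , inj₂ (x≡bi , y≡ai)) x≡y = a≢b i i (trans (sym y≡ai) (trans (sym x≡y) x≡bi))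

    matched-unique : ∀ {x y z} → Matched x y → Matched x z → y ≡ z
    matched-unique (i , inj₁ (x≡ai , y≡bi)) (j , inj₁ (x≡aj , z≡bj))
      with refl ← a-injective (trans (sym x≡ai) x≡aj) = trans y≡bi (sym z≡bj)
    matched-unique (i , inj₁ (x≡ai , _)) (j , inj₂ (x≡bj , _)) = contradiction (trans (sym x≡ai) x≡bj) (a≢b i j)
    matched-unique (i , inj₂ (x≡bi , _)) (j , inj₁ (x≡aj , _)) = contradiction (trans (sym x≡aj) x≡bi) (a≢b j i)
    matched-unique (i , inj₂ (x≡bi , y≡ai)) (j , inj₂ (x≡bj , z≡aj))
      with refl ← b-injective (trans (sym x≡bi) x≡bj) = trans y≡ai (sym z≡aj)

    endpoint-injective : Injective _≡_ _≡_ endpoint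
    endpoint-injective = either-splitAt-injective a-injective b-injective a≢b

-- Complete graphs minus matchings

module CompleteMinusMatching {N r t : ℕ}
  (a b : Fin t → Fin N) (ab : IsMatching a b) (c d : Fin t → Fin (suc r)) (cd : IsMatching c d) where

  R : Graph
  R = completeMinus N t a b

  G : Graph
  G = completeMinus (suc r) t c d

  copy-spanned : ∀ {S} (g : Fin (suc r) → Fin N) → Injective _≡_ _≡_ g → (∀ x → S (g x)) → ContainsIn G R S
  copy-spanned g g-injective g∈S = f , f-injective , (λ x → g∈S (σ ⟨$⟩ʳ x)) , hom
    where
    alignment = aligningPermutation refl g (endpoint-injective c d cd) (endpoint-injective a b ab)
    σ = proj₁ alignment

    f : Fin (suc r) → Fin N
    f x = g (σ ⟨$⟩ʳ x)

    f-injective : Injective _≡_ _≡_ f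
    f-injective = ⟨$⟩ʳ-injective σ ∘ g-injective

    pull : ∀ p {x} → f x ≡ endpoint a b p → x ≡ endpoint c d p
    pull p {x} fx≡ = f-injective (trans fx≡ (sym (proj₂ alignment p (σ ⟨$⟩ʳ x , fx≡))))

    pullˡ : ∀ i {x} → f x ≡ a i → x ≡ c i
    pullˡ i fx≡ = trans (pull (i ↑ˡ t) (trans fx≡ (sym (endpoint-↑ˡ a b i)))) (endpoint-↑ˡ c d i)

    pullʳ : ∀ i {x} → f x ≡ b i → x ≡ d i
    pullʳ i fx≡ = trans (pull (t ↑ʳ i) (trans fx≡ (sym (endpoint-↑ʳ a b i)))) (endpoint-↑ʳ c d i)

    hom : Hom G R f
    hom x y (x≢y , unmatched) = x≢y ∘ f-injective , λ where
      (i , inj₁ (fx≡ai , fy≡bi)) → unmatched (i , inj₁ (pullˡ i fx≡ai , pullʳ i fy≡bi))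
      (i , inj₂ (fx≡bi , fy≡ai)) → unmatched (i , inj₂ (pullʳ i fx≡bi , pullˡ i fy≡ai))

  preimages-matched : ∀ {H f} → Hom G H f → ∀ {x y w w'} → f x ≡ w → f y ≡ w' → w ≢ w' → ¬ Adj H w w' →
    Matched c d x y
  preimages-matched {f = f} hom refl refl w≢w' ¬w~w' = ¬adjacent⇒matched c d (w≢w' ∘ cong f) (¬w~w' ∘ hom _ _)

  ¬colourable : ∀ {j} → j * r < N → ¬ GFreeColourable G R j
  ¬colourable jr<N (π , free) with i , g , g-injective , g∈i ← largeClass π jr<N =
    free i (copy-spanned {λ w → π w ≡ i} g g-injective g∈i)

  chromaticNumber : ∀ {k'} → N ≡ suc (k' * r) → 0 < r → IsGFreeChromaticNumber G R (suc k')
  chromaticNumber {k'} N≡ 0<r =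
    fewVertices⇒colourable G R (n<1+n r) (subst (_≤ suc k' * r) (sym N≡) (+-monoˡ-≤ (k' * r) 0<r)) ,
    λ { j (s≤s j≤k') → ¬colourable (subst (j * r <_) (sym N≡) (s≤s (*-monoˡ-≤ r j≤k'))) }

  module EdgeDeleted {u v : Fin N} (u~v : Adj R u v) where

    H : Graph
    H = deleteEdge R u v

    uv-deleted : ¬ Adj H u v
    uv-deleted (_ , kept) = kept (inj₁ (refl , refl))

    vu-deleted : ¬ Adj H v u
    vu-deleted (_ , kept) = kept (inj₂ (refl , refl))

    -- With a colour of its own for u, the copies of G found in the other classes avoid u,
    -- so they survive the deletion of uv.
    isolate : ∀ {j} → (Fin N → Fin j) → Fin N → Fin (suc j)
    isolate π w with w ≟ᶠ u
    ... | yes _ = zero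
    ... | no _ = suc (π w)

    isolate≡zero : ∀ {j} {π : Fin N → Fin j} {w} → isolate π w ≡ zero → w ≡ u
    isolate≡zero {w = w} eq with w ≟ᶠ u
    ... | yes w≡u = w≡u

    isolate≡suc : ∀ {j} {π : Fin N → Fin j} {w i} → isolate π w ≡ suc i → w ≢ u × π w ≡ i
    isolate≡suc {w = w} eq with w ≟ᶠ u
    ... | no w≢u = w≢u , suc-injective eq

    ¬colourable′ : ∀ {j} → 0 < r → suc j * r < N → ¬ GFreeColourable G H j
    ¬colourable′ 0<r jr<N (π , free) with largeClass (isolate π) jr<N
    ... | zero , g , g-injective , g∈u =
      contradiction (g-injective (trans (isolate≡zero (g∈u zero)) (sym (isolate≡zero (g∈u (suc (fromℕ< 0<r)))))))
                    λ ()
    ... | suc i , g , g-injective , g∈i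
      with f , f-injective , f∈i , hom ← copy-spanned {λ w → isolate π w ≡ suc i} g g-injective g∈i
      = free i (f , f-injective , proj₂ ∘ isolate≡suc ∘ f∈i , hom-deleteEdge {G} {R} hom (proj₁ ∘ isolate≡suc ∘ f∈i))

    -- A copy containing w, w' and the partner z of w would pull both non-edges ww' and wz back
    -- to G, giving a vertex of G two partners.
    cherry-colourable : ∀ {j w w' p} → N ≡ suc r + j * r → t + t + 2 ≤ suc r →
      Adj R w w' → ¬ Adj H w w' → endpoint a b p ≡ w → GFreeColourable G H (suc j)
    cherry-colourable {w = w} {w'} {p} sizes 2t+2≤m (w≢w' , unmatched) ¬w~w' ep≡w =
      uncovered⇒colourable G H (n<1+n r) sizes 3≤m (Vec.lookup triple) (Vec-lookup-injective distinct _ _) uncovered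
      where
      3≤m : 3 ≤ suc r
      3≤m = ≤-trans (+-monoˡ-≤ 2 (≤-trans (s≤s z≤n) (toℕ<n p))) 2t+2≤m

      z = endpoint a b (proj₁ (endpoint-matched a b p))

      w-z : Matched a b w z
      w-z = subst (λ x → Matched a b x z) ep≡w (proj₂ (endpoint-matched a b p))

      w≢z : w ≢ z
      w≢z = matched⇒≢ a b ab w-z

      w'≢z : w' ≢ z
      w'≢z w'≡z = unmatched (subst (Matched a b w) (sym w'≡z) w-z)

      triple = w ∷ w' ∷ z ∷ []

      distinct = (w≢w' ∷ w≢z ∷ []) ∷ (w'≢z ∷ []) ∷ [] ∷ []

      uncovered : ∀ f → Injective _≡_ _≡_ f → Hom G H f → ¬ (∀ y → ∃ λ x → f x ≡ Vec.lookup triple y)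
      uncovered f f-injective hom covered
        with xw , fxw ← covered zero | xw' , fxw' ← covered (suc zero) | xz , fxz ← covered (suc (suc zero))
        = w'≢z (trans (sym fxw') (trans (cong f xw'≡xz) fxz))
        where
        xw'≡xz : xw' ≡ xz
        xw'≡xz = matched-unique c d cd (preimages-matched {H} {f} hom fxw fxw' w≢w' ¬w~w')
                                       (preimages-matched {H} {f} hom fxw fxz w≢z (λ w~z → proj₂ (proj₁ w~z) w-z))

    -- Each of the 2t + 2 vertices u, v, a i, b i has a non-neighbour among them, so a copy
    -- containing them all would make their 2t + 2 preimages endpoints of G's t-matching.
    unmatched-colourable : ∀ {j} → N ≡ suc r + j * r → 2 + (t + t) ≤ suc r →
      (∀ p → endpoint a b p ≢ u) → (∀ p → endpoint a b p ≢ v) → GFreeColourable G H (suc j)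
    unmatched-colourable sizes s≤m u-unmatched v-unmatched =
      uncovered⇒colourable G H (n<1+n r) sizes s≤m e e-injective uncovered
      where
      edge = u ∷ v ∷ []

      e : Fin (2 + (t + t)) → Fin N
      e p = [ Vec.lookup edge , endpoint a b ]′ (splitAt 2 p)

      e-injective : Injective _≡_ _≡_ e
      e-injective =
        either-splitAt-injective (Vec-lookup-injective ((proj₁ u~v ∷ []) ∷ [] ∷ []) _ _) (endpoint-injective a b ab) disjoint
        where
        disjoint : ∀ x p → Vec.lookup edge x ≢ endpoint a b p
        disjoint zero p = u-unmatched p ∘ sym
        disjoint (suc zero) p = v-unmatched p ∘ sym

      non-neighbour : ∀ y → ∃ λ y' → e y ≢ e y' × ¬ Adj H (e y) (e y')
      non-neighbour zero = suc zero , proj₁ u~v , uv-deleted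
      non-neighbour (suc zero) = zero , proj₁ u~v ∘ sym , vu-deleted
      non-neighbour (suc (suc p)) with q , p-q ← endpoint-matched a b p =
        suc (suc q) , matched⇒≢ a b ab p-q , λ ep~eq → proj₂ (proj₁ ep~eq) p-q

      uncovered : ∀ f → Injective _≡_ _≡_ f → Hom G H f → ¬ (∀ y → ∃ λ x → f x ≡ e y)
      uncovered f f-injective hom covered = <⇒notInjective (m<n⇒m<1+n (n<1+n (t + t))) index-injective
        where
        preimage-endpoint : ∀ y → ∃ λ p → endpoint c d p ≡ proj₁ (covered y)
        preimage-endpoint y with y' , ey≢ey' , ¬ey~ey' ← non-neighbour y =
          matched⇒endpoint c d (preimages-matched {H} {f} hom (proj₂ (covered y)) (proj₂ (covered y')) ey≢ey' ¬ey~ey')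

        index-injective : Injective _≡_ _≡_ (proj₁ ∘ preimage-endpoint)
        index-injective {y} {y'} eq = e-injective (begin
          e y                     ≡⟨ proj₂ (covered y) ⟨
          f (proj₁ (covered y))   ≡⟨ cong f (trans (sym (proj₂ (preimage-endpoint y)))
                                              (trans (cong (endpoint c d) eq) (proj₂ (preimage-endpoint y')))) ⟩
          f (proj₁ (covered y'))  ≡⟨ proj₂ (covered y') ⟩
          e y'                    ∎)
          where open ≡-Reasoning

    colourable : ∀ {j} → N ≡ suc r + j * r → t + t + 2 ≤ suc r → GFreeColourable G H (suc j)
    colourable sizes 2t+2≤m with any? (λ p → endpoint a b p ≟ᶠ u) | any? (λ p → endpoint a b p ≟ᶠ v)
    ... | yes (p , ep≡u) | _ = cherry-colourable sizes 2t+2≤m u~v uv-deleted ep≡u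
    ... | no _ | yes (p , ep≡v) = cherry-colourable sizes 2t+2≤m (adjSym R u~v) vu-deleted ep≡v
    ... | no u-unmatched | no v-unmatched =
      unmatched-colourable sizes (subst (_≤ suc r) (+-comm (t + t) 2) 2t+2≤m)
                           (λ p → u-unmatched ∘ (p ,_)) (λ p → v-unmatched ∘ (p ,_))

    chromaticNumber′ : ∀ {k''} → N ≡ suc (suc k'' * r) → 0 < r → t + t + 2 ≤ suc r →
      IsGFreeChromaticNumber G H (suc k'')
    chromaticNumber′ {k''} N≡ 0<r 2t+2≤m =
      colourable N≡ 2t+2≤m ,
      λ { j (s≤s j≤k'') → ¬colourable′ 0<r (subst (suc j * r <_) (sym N≡) (s≤s (*-monoˡ-≤ r (s≤s j≤k'')))) }

theorem15 : (k m t : ℕ) → 1 ≤ k → t + t + 2 ≤ m →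
    (a b : Fin t → Fin ((k ∸ 1) * (m ∸ 1) + 1)) → IsMatching a b →
    (c d : Fin t → Fin m) → IsMatching c d →
    IsKGFreeMinimal k (completeMinus m t c d) (completeMinus ((k ∸ 1) * (m ∸ 1) + 1) t a b)
theorem15 (suc zero) (suc (suc r)) t _ _ a b ab c d cd =
  chromaticNumber refl (s≤s z≤n) , λ { zero zero (0≢0 , _) → contradiction refl 0≢0 }
  where open CompleteMinusMatching a b ab c d cd
theorem15 (suc (suc k'')) (suc (suc r)) t _ 2t+2≤m a b ab c d cd =
  chromaticNumber N≡ (s≤s z≤n) , λ u v u~v → EdgeDeleted.chromaticNumber′ u~v N≡ (s≤s z≤n) 2t+2≤m
  where
  open CompleteMinusMatching a b ab c d cd
  N≡ = +-comm (suc k'' * suc r) 1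
theorem15 (suc _) zero t _ 2t+2≤0 = contradiction (≤-trans (m≤n+m 2 (t + t)) 2t+2≤0) λ ()
theorem15 (suc _) (suc zero) t _ 2t+2≤1 = contradiction (≤-trans (m≤n+m 2 (t + t)) 2t+2≤1) λ { (s≤s ()) }
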